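{- For every integer $n\ge 3$, the cycle $C_n$ satisfies $$\mathrm{avg}_1(C_n) = \frac{3^n + (-1)^n}{2\binom{n}{0}_2},$$ where $\binom{n}{0}_2$ is the $n$-th central trinomial coefficient.
   Context: Trinomial coefficients $\binom{n}{k}_2$ ($n\ge 0$, $k\in\mathbb{Z}$) are defined by $\binom{0}{0}_2=1$, $\binom{0}{k}_2=0$ for $k\neq 0$, and $\binom{n+1}{k}_2=\binom{n}{k-1}_2+\binom{n}{k}_2+\binom{n}{k+1}_2$; equivalently $\binom{n}{k}_2$ is the coefficient of $x^k$ in $(x^{ -1}+1+x)^n$. The central trinomial coefficients are $\binom{n}{0}_2$. Let $G=(V,E)$ be a finite connected graph with a fixed root $v_0$. A $1$-Lipschitz mapping of $G$ is a map $f:V\to\mathbb{Z}$ with $f(v_0)=0$ and $|f(u)-f(v)|\le 1$ for every edge $uv$; the set of these is $\mathcal{L}_1(G)$. The range of $f$ is $\mathrm{rng}(f)=|\{f(v):v\in V\}|$, and $\mathrm{avg}_1(G)=\frac{\sum_{f\in\mathcal{L}_1(G)}\mathrm{rng}(f)}{|\mathcal{L}_1(G)|}$ (independent of the choice of root). -}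

module Defs where

open import Data.Nat as ℕ using (ℕ; zero; suc; _%_)
open import Data.Integer as ℤ using (ℤ; +_; ∣_∣)
open import Data.Fin using (Fin; toℕ; zero)
open import Data.Vec using (Vec; lookup; toList)
open import Data.List using (List; length; map; deduplicate)
open import Data.Nat.ListAction using (sum)
open import Data.List.Relation.Unary.Unique.Propositional using (Unique)
open import Data.List.Membership.Propositional using (_∈_)
open import Data.Rational as ℚ using (ℚ)
open import Data.Product using (Σ; _×_)
open import Data.Sum using (_⊎_)
open import Relation.Binary.PropositionalEquality using (_≡_)
open import Function.Bundles using (_⇔_)

-- Trinomial coefficients: binom n k _2 = coefficient of x^k in (x⁻¹ + 1 + x)^n.
trinomial : ℕ → ℤ → ℕ
trinomial zero (+ zero) = 1
trinomial zero _        = 0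
trinomial (suc n) k = trinomial n (k ℤ.- ℤ.1ℤ) ℕ.+ trinomial n k ℕ.+ trinomial n (k ℤ.+ ℤ.1ℤ)

centralTrinomial : ℕ → ℕ
centralTrinomial n = trinomial n (+ 0)

record RootedGraph : Set₁ where
  field
    size : ℕ
    Adj  : Fin size → Fin size → Set
    root : Fin size
open RootedGraph public

-- The cycle C_{k+1} on vertices 0,…,k, edges i — i+1 (mod k+1), rooted at 0.
cycle : ℕ → RootedGraph
cycle k = record
  { size = suc k
  ; Adj  = λ i j → (toℕ j ≡ suc (toℕ i) % suc k) ⊎ (toℕ i ≡ suc (toℕ j) % suc k)
  ; root = zero
  }

IsLipschitz1 : (G : RootedGraph) → Vec ℤ (size G) → Set
IsLipschitz1 G f =
  (lookup f (root G) ≡ + 0) ×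
  (∀ u v → Adj G u v → ∣ lookup f u ℤ.- lookup f v ∣ ℕ.≤ 1)

rng : ∀ {n} → Vec ℤ n → ℕ
rng f = length (deduplicate ℤ._≟_ (toList f))

Enumerates : (G : RootedGraph) → List (Vec ℤ (size G)) → Set
Enumerates G L = Unique L × (∀ f → (f ∈ L) ⇔ IsLipschitz1 G f)

-- Division p / d in ℚ, with the (never used here) convention p / 0 = 0.
frac : ℤ → ℕ → ℚ
frac p zero    = ℚ.0ℚ
frac p (suc d) = p ℚ./ suc d

avgOf : ∀ {n} → List (Vec ℤ n) → ℚ
avgOf L = frac (+ sum (map rng L)) (length L)

-- A 1-Lipschitz map of the cycle on 0, …, k rooted at 0 is a lazy walk 0 = x₀, …, x_k with
-- steps of size at most 1 and |x_k| ≤ 1; lazy walks of this kind from a are counted by the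
-- trinomial coefficient T(k+1, a).  Writing rng f as the number of integers v visited by f and
-- exchanging sums, Σ rng is the sum over v of the number of walks from 0 visiting v, which by a
-- reflection argument is T(k+1, 2v).  The even and odd parts E, O of row n satisfy
-- E' = E + 2O and O' = O + 2E, hence E + O = 3ⁿ and E − O = (−1)ⁿ, so 2 Σ rng = 3ⁿ + (−1)ⁿ.

module Submission where

open import Defs
open import Data.Nat using (ℕ; suc)
open import Data.Integer using (ℤ; +_; -_; _+_; _^_)
open import Data.List using (List)
open import Data.Vec using (Vec)
open import Data.Product using (Σ; _×_)
open import Relation.Binary.PropositionalEquality using (_≡_)

open import Data.Empty using (⊥-elim)
open import Data.Fin as Fin using (Fin; toℕ; fromℕ; inject₁)
import Data.Fin.Properties as Fin
open import Data.Integer as ℤ using (_-_; -[1+_]; +[1+_]; ∣_∣; 0ℤ; 1ℤ; _≟_)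
import Data.Integer.Properties as ℤ
open import Algebra.Properties.AbelianGroup ℤ.+-0-abelianGroup using (∙-cancelˡ)
open import Data.Integer.Tactic.RingSolver using (solve-∀)
open import Data.List using ([]; _∷_; _++_; map; length; filter; deduplicate)
import Data.List.Properties as List
open import Data.List.Membership.Propositional using (_∈_)
open import Data.List.Membership.Propositional.Properties
  using ( ∈-map⁺; ∈-map⁻; ∈-++⁺ˡ; ∈-++⁺ʳ; ∈-++⁻; ∈-filter⁺; ∈-filter⁻
        ; ∈-deduplicate⁺; ∈-deduplicate⁻)
open import Data.List.Membership.Propositional.Properties.WithK using (unique∧set⇒bag)
open import Data.List.Relation.Unary.Any using (here; there)
open import Data.List.Relation.Unary.All as All using ([]; _∷_)
open import Data.List.Relation.Unary.AllPairs using ([]; _∷_)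
open import Data.List.Relation.Unary.Unique.Propositional using (Unique)
import Data.List.Relation.Unary.Unique.Propositional.Properties as Unique
import Data.List.Relation.Unary.Unique.DecPropositional.Properties as UniqueDec
open import Data.List.Relation.Binary.Disjoint.Propositional using (Disjoint)
open import Data.List.Relation.Binary.Permutation.Propositional using (_↭_)
open import Data.List.Relation.Binary.Permutation.Propositional.Properties using (↭-length)
import Data.List.Relation.Binary.Permutation.Propositional.Properties as ↭
open import Data.List.Relation.Binary.BagAndSetEquality using (∼bag⇒↭)
open import Data.Nat as ℕ using (zero; _≤_; _<_; z≤n; s≤s)
import Data.Nat.Properties as ℕ
open import Data.Nat.DivMod using (m<n⇒m%n≡m; n%n≡0)
open import Data.Nat.ListAction using (sum)
open import Data.Nat.ListAction.Properties using (sum-++; sum-↭)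
open import Algebra.Properties.CommutativeSemigroup ℕ.+-commutativeSemigroup
  using (xy∙z≈zy∙x; xy∙z≈zx∙y) renaming (interchange to +-interchange)
open import Data.Product using (_,_; proj₁; proj₂)
import Data.Rational.Properties as ℚ
import Data.Rational.Unnormalised as ℚᵘ
open import Data.Sum using (_⊎_; inj₁; inj₂; [_,_])
open import Data.Vec using ([]; _∷_; toList; head; lookup)
import Data.Vec.Properties as Vec
open import Function.Base using (_∘_)
open import Function.Bundles using (_⇔_; mk⇔; Equivalence)
open import Function.Construct.Composition using (_⇔-∘_)
open import Function.Construct.Symmetry using (⇔-sym)
open import Relation.Binary.Definitions using (DecidableEquality)
open import Relation.Binary.PropositionalEquality
  using (refl; sym; trans; cong; cong₂; subst; _≢_; module ≡-Reasoning)
open import Relation.Nullary using (Dec; yes; no)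
open import Relation.Unary using (Decidable)

private variable
  A B : Set

indicator : {P : Set} → Dec P → ℕ
indicator (yes _) = 1
indicator (no _)  = 0

indicator-⇔ : {P Q : Set} → P ⇔ Q → (p : Dec P) (q : Dec Q) → indicator p ≡ indicator q
indicator-⇔ _   (yes _) (yes _)  = refl
indicator-⇔ P⇔Q (yes p) (no ¬q)  = ⊥-elim (¬q (Equivalence.to P⇔Q p))
indicator-⇔ P⇔Q (no ¬p) (yes q)  = ⊥-elim (¬p (Equivalence.from P⇔Q q))
indicator-⇔ _   (no _)  (no _)   = refl

∈-∷⇔ : {x y : A} {xs : List A} → x ≢ y → x ∈ y ∷ xs ⇔ x ∈ xs
∈-∷⇔ x≢y = mk⇔ (λ { (here x≡y) → ⊥-elim (x≢y x≡y) ; (there x∈) → x∈ }) there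

sum-map-++ : (g : A → ℕ) (xs ys : List A) →
             sum (map g (xs ++ ys)) ≡ sum (map g xs) ℕ.+ sum (map g ys)
sum-map-++ g xs ys = trans (cong sum (List.map-++ g xs ys)) (sum-++ (map g xs) (map g ys))

sum-map-+ : (g h : A → ℕ) (xs : List A) →
            sum (map (λ x → g x ℕ.+ h x) xs) ≡ sum (map g xs) ℕ.+ sum (map h xs)
sum-map-+ g h []       = refl
sum-map-+ g h (x ∷ xs) = begin
  g x ℕ.+ h x ℕ.+ sum (map (λ x → g x ℕ.+ h x) xs)   ≡⟨ cong (g x ℕ.+ h x ℕ.+_) (sum-map-+ g h xs) ⟩
  g x ℕ.+ h x ℕ.+ (sum (map g xs) ℕ.+ sum (map h xs)) ≡⟨ +-interchange (g x) (h x) _ _ ⟩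
  g x ℕ.+ sum (map g xs) ℕ.+ (h x ℕ.+ sum (map h xs)) ∎
  where open ≡-Reasoning

sum-map-zero : (g : A → ℕ) (xs : List A) → (∀ {x} → x ∈ xs → g x ≡ 0) → sum (map g xs) ≡ 0
sum-map-zero g []       g≡0 = refl
sum-map-zero g (x ∷ xs) g≡0 = cong₂ ℕ._+_ (g≡0 (here refl)) (sum-map-zero g xs (g≡0 ∘ there))

sum-map-comm : (g : A → B → ℕ) (xs : List A) (ys : List B) →
               sum (map (λ x → sum (map (g x) ys)) xs) ≡ sum (map (λ y → sum (map (λ x → g x y) xs)) ys)
sum-map-comm g []       ys = sym (sum-map-zero _ ys (λ _ → refl))
sum-map-comm g (x ∷ xs) ys = trans (cong (sum (map (g x) ys) ℕ.+_) (sum-map-comm g xs ys))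
                                   (sym (sum-map-+ (g x) _ ys))

sum-map-single : (g : A → ℕ) {xs : List A} {p : A} → Unique xs → p ∈ xs →
                 (∀ x → x ≢ p → g x ≡ 0) → sum (map g xs) ≡ g p
sum-map-single g (p∉xs ∷ _) (here refl) g≡0 =
  trans (cong (g _ ℕ.+_) (sum-map-zero g _ (λ x∈xs → g≡0 _ (λ { refl → All.lookup p∉xs x∈xs refl }))))
        (ℕ.+-identityʳ _)
sum-map-single g {x ∷ _} (x∉xs ∷ uxs) (there p∈xs) g≡0 =
  cong₂ ℕ._+_ (g≡0 x (λ { refl → All.lookup x∉xs p∈xs refl })) (sum-map-single g uxs p∈xs g≡0)

length-filter≡sum-indicator : {P : A → Set} (P? : Decidable P) (xs : List A) →
                length (filter P? xs) ≡ sum (map (indicator ∘ P?) xs)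
length-filter≡sum-indicator P? []       = refl
length-filter≡sum-indicator P? (x ∷ xs) with P? x
... | yes _ = cong suc (length-filter≡sum-indicator P? xs)
... | no  _ = length-filter≡sum-indicator P? xs

unique-↭ : {xs ys : List A} → Unique xs → Unique ys → (∀ {z} → z ∈ xs ⇔ z ∈ ys) → xs ↭ ys
unique-↭ uxs uys xs≈ys = ∼bag⇒↭ (unique∧set⇒bag uxs uys xs≈ys)

module _ (_≟_ : DecidableEquality A) where
  open import Data.List.Membership.DecPropositional _≟_ using (_∈?_)

  length-deduplicate : (xs R : List A) → Unique R → (∀ {x} → x ∈ xs → x ∈ R) →
                       length (deduplicate _≟_ xs) ≡ sum (map (λ v → indicator (v ∈? xs)) R)
  length-deduplicate xs R uR xs⊆R = trans
    (↭-length (unique-↭ (UniqueDec.deduplicate-! _≟_ xs) (Unique.filter⁺ (_∈? xs) uR)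
                             (mk⇔ to from)))
    (length-filter≡sum-indicator (_∈? xs) R)
    where
    to : ∀ {z} → z ∈ deduplicate _≟_ xs → z ∈ filter (_∈? xs) R
    to z∈ = let z∈xs = ∈-deduplicate⁻ _≟_ xs z∈ in ∈-filter⁺ (_∈? xs) (xs⊆R z∈xs) z∈xs
    from : ∀ {z} → z ∈ filter (_∈? xs) R → z ∈ deduplicate _≟_ xs
    from z∈ = ∈-deduplicate⁺ _≟_ (proj₂ (∈-filter⁻ (_∈? xs) {xs = R} z∈))

+-cancelˡ-≢ : ∀ i {j k} → j ≢ k → i + j ≢ i + k
+-cancelˡ-≢ i j≢k = j≢k ∘ ∙-cancelˡ i _ _

∣i-0∣≡∣i∣ : ∀ i → ∣ i - 0ℤ ∣ ≡ ∣ i ∣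
∣i-0∣≡∣i∣ i = cong ∣_∣ (ℤ.+-identityʳ i)

∣i-i∣≤n : ∀ i {n} → ∣ i - i ∣ ≤ n
∣i-i∣≤n i = subst (_≤ _) (cong ∣_∣ (sym (ℤ.+-inverseʳ i))) z≤n

∣i∣≤∣i+j∣+∣j∣ : ∀ i j → ∣ i ∣ ≤ ∣ i + j ∣ ℕ.+ ∣ j ∣
∣i∣≤∣i+j∣+∣j∣ i j =
  subst (λ x → ∣ x ∣ ≤ ∣ i + j ∣ ℕ.+ ∣ j ∣) (i+j-j≡i i j) (ℤ.∣i-j∣≤∣i∣+∣j∣ (i + j) j)
  where
  i+j-j≡i : ∀ i j → i + j - j ≡ i
  i+j-j≡i = solve-∀

∣i+i∣≡∣i∣+∣i∣ : ∀ i → ∣ i + i ∣ ≡ ∣ i ∣ ℕ.+ ∣ i ∣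
∣i+i∣≡∣i∣+∣i∣ (+ m)    = refl
∣i+i∣≡∣i∣+∣i∣ -[1+ m ] = cong suc (sym (ℕ.+-suc m m))

<∣+∣ : ∀ {n} k s → ∣ s ∣ ≤ 1 → suc n < ∣ k ∣ → n < ∣ k + s ∣
<∣+∣ {n} k s ∣s∣≤1 n<k = ℕ.+-cancelʳ-≤ 1 (suc n) ∣ k + s ∣ (begin
  suc n ℕ.+ 1          ≡⟨ ℕ.+-comm (suc n) 1 ⟩
  suc (suc n)          ≤⟨ n<k ⟩
  ∣ k ∣                ≤⟨ ∣i∣≤∣i+j∣+∣j∣ k s ⟩
  ∣ k + s ∣ ℕ.+ ∣ s ∣  ≤⟨ ℕ.+-monoʳ-≤ ∣ k + s ∣ ∣s∣≤1 ⟩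
  ∣ k + s ∣ ℕ.+ 1      ∎)
  where open ℕ.≤-Reasoning

trinomial-vanish : ∀ n k → n < ∣ k ∣ → trinomial n k ≡ 0
trinomial-vanish zero    (+ zero)  ()
trinomial-vanish zero    +[1+ _ ]  _ = refl
trinomial-vanish zero    -[1+ _ ]  _ = refl
trinomial-vanish (suc n) k n<k = cong₂ ℕ._+_
  (cong₂ ℕ._+_ (trinomial-vanish n (k - 1ℤ) (<∣+∣ k (- 1ℤ) ℕ.≤-refl n<k))
               (trinomial-vanish n k (ℕ.<-trans (ℕ.n<1+n n) n<k)))
  (trinomial-vanish n (k + 1ℤ) (<∣+∣ k 1ℤ ℕ.≤-refl n<k))

trinomial-vanish-double : ∀ n v s → ∣ s ∣ ≤ 1 → n < ∣ v ∣ → trinomial n (v + v + s) ≡ 0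
trinomial-vanish-double n v s ∣s∣≤1 n<v = trinomial-vanish n (v + v + s) (<∣+∣ (v + v) s ∣s∣≤1 (begin
  suc (suc n)          ≤⟨ s≤s (ℕ.m≤n+m (suc n) n) ⟩
  suc n ℕ.+ suc n      ≤⟨ ℕ.+-mono-≤ n<v n<v ⟩
  ∣ v ∣ ℕ.+ ∣ v ∣      ≡⟨ ∣i+i∣≡∣i∣+∣i∣ v ⟨
  ∣ v + v ∣            ∎))
  where open ℕ.≤-Reasoning

-i-1≡-[i+1] : ∀ i → - i - 1ℤ ≡ - (i + 1ℤ)
-i-1≡-[i+1] = solve-∀

-i+1≡-[i-1] : ∀ i → - i + 1ℤ ≡ - (i - 1ℤ)
-i+1≡-[i-1] = solve-∀

trinomial-neg : ∀ n k → trinomial n (- k) ≡ trinomial n k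
trinomial-neg zero    (+ zero) = refl
trinomial-neg zero    +[1+ _ ] = refl
trinomial-neg zero    -[1+ _ ] = refl
trinomial-neg (suc n) k = begin
  T (- k - 1ℤ) ℕ.+ T (- k) ℕ.+ T (- k + 1ℤ)
    ≡⟨ cong₂ ℕ._+_ (cong₂ ℕ._+_ (cong T (-i-1≡-[i+1] k)) refl) (cong T (-i+1≡-[i-1] k)) ⟩
  T (- (k + 1ℤ)) ℕ.+ T (- k) ℕ.+ T (- (k - 1ℤ))
    ≡⟨ cong₂ ℕ._+_ (cong₂ ℕ._+_ (trinomial-neg n (k + 1ℤ)) (trinomial-neg n k)) (trinomial-neg n (k - 1ℤ)) ⟩
  T (k + 1ℤ) ℕ.+ T k ℕ.+ T (k - 1ℤ)
    ≡⟨ xy∙z≈zy∙x (T (k + 1ℤ)) (T k) (T (k - 1ℤ)) ⟩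
  T (k - 1ℤ) ℕ.+ T k ℕ.+ T (k + 1ℤ)
    ∎
  where
  open ≡-Reasoning
  T = trinomial n

-- Walks and the 1-Lipschitz maps of a cycle

-- Walk a f: f starts at a, moves by at most 1 per step and ends in [-1, 1]; for a = 0 these
-- are the 1-Lipschitz maps of the cycle, read around it from the root.
data Walk : {k : ℕ} → ℤ → Vec ℤ (suc k) → Set where
  end  : ∀ {a} → ∣ a ∣ ≤ 1 → Walk a (a ∷ [])
  step : ∀ {k a b} {f : Vec ℤ k} → ∣ a - b ∣ ≤ 1 → Walk b (b ∷ f) → Walk a (a ∷ b ∷ f)

walks : (k : ℕ) → ℤ → List (Vec ℤ (suc k))
walks zero a with ∣ a ∣ ℕ.≤? 1
... | yes _ = (a ∷ []) ∷ []
... | no  _ = []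
walks (suc k) a = map (a ∷_) (walks k (a - 1ℤ) ++ walks k a ++ walks k (a + 1ℤ))

length-walks : ∀ k a → length (walks k a) ≡ trinomial (suc k) a
length-walks zero (+ zero)          = refl
length-walks zero +[1+ zero ]       = refl
length-walks zero +[1+ suc _ ]      = refl
length-walks zero -[1+ zero ]       = refl
length-walks zero -[1+ suc _ ]      = refl
length-walks (suc k) a = begin
  length (map (a ∷_) (W₋ ++ W₀ ++ W₊))     ≡⟨ List.length-map (a ∷_) (W₋ ++ W₀ ++ W₊) ⟩
  length (W₋ ++ W₀ ++ W₊)                  ≡⟨ List.length-++ W₋ ⟩
  length W₋ ℕ.+ length (W₀ ++ W₊)          ≡⟨ cong (length W₋ ℕ.+_) (List.length-++ W₀) ⟩
  length W₋ ℕ.+ (length W₀ ℕ.+ length W₊)  ≡⟨ ℕ.+-assoc (length W₋) _ _ ⟨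
  length W₋ ℕ.+ length W₀ ℕ.+ length W₊
    ≡⟨ cong₂ ℕ._+_ (cong₂ ℕ._+_ (length-walks k (a - 1ℤ)) (length-walks k a)) (length-walks k (a + 1ℤ)) ⟩
  trinomial (suc (suc k)) a                ∎
  where
  open ≡-Reasoning
  W₋ = walks k (a - 1ℤ)
  W₀ = walks k a
  W₊ = walks k (a + 1ℤ)

walk-cons : ∀ {k a b} {f : Vec ℤ (suc k)} → ∣ a - b ∣ ≤ 1 → Walk b f → Walk a (a ∷ f)
walk-cons a~b w@(end _)    = step a~b w
walk-cons a~b w@(step _ _) = step a~b w

walk-head : ∀ {k a} {f : Vec ℤ (suc k)} → Walk a f → head f ≡ a
walk-head (end _)    = refl
walk-head (step _ _) = refl

walk-start∈ : ∀ {k a} {f : Vec ℤ (suc k)} → Walk a f → a ∈ toList f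
walk-start∈ (end _)    = here refl
walk-start∈ (step _ _) = here refl

neighbours : ∀ a b → ∣ a - b ∣ ≤ 1 → b ≡ a - 1ℤ ⊎ b ≡ a ⊎ b ≡ a + 1ℤ
neighbours a b a~b =
  subst (λ c → c ≡ a - 1ℤ ⊎ c ≡ a ⊎ c ≡ a + 1ℤ) (a-[a-b]≡b a b) (offset (a - b) a~b)
  where
  a-[a-b]≡b : ∀ a b → a - (a - b) ≡ b
  a-[a-b]≡b = solve-∀
  offset : ∀ d → ∣ d ∣ ≤ 1 → a - d ≡ a - 1ℤ ⊎ a - d ≡ a ⊎ a - d ≡ a + 1ℤ
  offset (+ zero)      _        = inj₂ (inj₁ (ℤ.+-identityʳ a))
  offset +[1+ zero ]   _        = inj₁ refl
  offset -[1+ zero ]   _        = inj₂ (inj₂ refl)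
  offset +[1+ suc _ ]  (s≤s ())
  offset -[1+ suc _ ]  (s≤s ())

∈-walks⇔ : ∀ k a {f} → f ∈ walks k a ⇔ Walk a f
∈-walks⇔ k a = mk⇔ (to k a) (from k a)
  where
  a-[a-1]≡1 : ∀ a → a - (a - 1ℤ) ≡ 1ℤ
  a-[a-1]≡1 = solve-∀
  a-[a+1]≡-1 : ∀ a → a - (a + 1ℤ) ≡ - 1ℤ
  a-[a+1]≡-1 = solve-∀

  to : ∀ k a {f} → f ∈ walks k a → Walk a f
  to zero a f∈ with ∣ a ∣ ℕ.≤? 1
  to zero a (here refl) | yes ∣a∣≤1 = end ∣a∣≤1
  to (suc k) a f∈ with g , g∈ , refl ← ∈-map⁻ (a ∷_) f∈ with ∈-++⁻ (walks k (a - 1ℤ)) g∈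
  ... | inj₁ g∈₋ = walk-cons (ℕ.≤-reflexive (cong ∣_∣ (a-[a-1]≡1 a))) (to k _ g∈₋)
  ... | inj₂ g∈₀₊ with ∈-++⁻ (walks k a) g∈₀₊
  ...   | inj₁ g∈₀ = walk-cons (∣i-i∣≤n a) (to k _ g∈₀)
  ...   | inj₂ g∈₊ = walk-cons (ℕ.≤-reflexive (cong ∣_∣ (a-[a+1]≡-1 a))) (to k _ g∈₊)

  from : ∀ k a {f} → Walk a f → f ∈ walks k a
  from zero a (end ∣a∣≤1) with ∣ a ∣ ℕ.≤? 1
  ... | yes _      = here refl
  ... | no  ∣a∣≰1  = ⊥-elim (∣a∣≰1 ∣a∣≤1)
  from (suc k) a (step {b = b} a~b w) = ∈-map⁺ (a ∷_) (place (neighbours a b a~b) (from k b w))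
    where
    place : ∀ {g} → b ≡ a - 1ℤ ⊎ b ≡ a ⊎ b ≡ a + 1ℤ → g ∈ walks k b →
            g ∈ walks k (a - 1ℤ) ++ walks k a ++ walks k (a + 1ℤ)
    place (inj₁ refl)        g∈ = ∈-++⁺ˡ g∈
    place (inj₂ (inj₁ refl)) g∈ = ∈-++⁺ʳ (walks k (a - 1ℤ)) (∈-++⁺ˡ g∈)
    place (inj₂ (inj₂ refl)) g∈ = ∈-++⁺ʳ (walks k (a - 1ℤ)) (∈-++⁺ʳ (walks k a) g∈)

walks-unique : ∀ k a → Unique (walks k a)
walks-unique zero a with ∣ a ∣ ℕ.≤? 1
... | yes _ = [] ∷ []
... | no  _ = []
walks-unique (suc k) a = Unique.map⁺ Vec.∷-injectiveʳ
  (Unique.++⁺ (walks-unique k (a - 1ℤ))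
              (Unique.++⁺ (walks-unique k a) (walks-unique k (a + 1ℤ)) (apart a≢a+1))
              λ (g∈₋ , g∈₀₊) → [ (λ g∈₀ → apart a-1≢a (g∈₋ , g∈₀))
                               , (λ g∈₊ → apart a-1≢a+1 (g∈₋ , g∈₊)) ] (∈-++⁻ (walks k a) g∈₀₊))
  where
  apart : ∀ {b c} → b ≢ c → Disjoint (walks k b) (walks k c)
  apart b≢c (g∈b , g∈c) = b≢c (trans (sym (walk-head (Equivalence.to (∈-walks⇔ k _) g∈b)))
                                      (walk-head (Equivalence.to (∈-walks⇔ k _) g∈c)))
  a-1≢a : a - 1ℤ ≢ a
  a-1≢a a-1≡a = +-cancelˡ-≢ a (λ ()) (trans a-1≡a (sym (ℤ.+-identityʳ a)))
  a≢a+1 : a ≢ a + 1ℤ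
  a≢a+1 a≡a+1 = +-cancelˡ-≢ a (λ ()) (trans (ℤ.+-identityʳ a) a≡a+1)
  a-1≢a+1 : a - 1ℤ ≢ a + 1ℤ
  a-1≢a+1 = +-cancelˡ-≢ a (λ ())

walk-steps : ∀ {k a} {f : Vec ℤ (suc k)} → Walk a f →
             ∀ i → ∣ lookup f (inject₁ i) - lookup f (Fin.suc i) ∣ ≤ 1
walk-steps (step a~b w) Fin.zero    = a~b
walk-steps (step a~b w) (Fin.suc i) = walk-steps w i

walk-last : ∀ {k a} {f : Vec ℤ (suc k)} → Walk a f → ∣ lookup f (fromℕ k) ∣ ≤ 1
walk-last (end ∣a∣≤1) = ∣a∣≤1
walk-last (step _ w)  = walk-last w

steps⇒walk : ∀ {k} (f : Vec ℤ (suc k)) → (∀ i → ∣ lookup f (inject₁ i) - lookup f (Fin.suc i) ∣ ≤ 1) →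
             ∣ lookup f (fromℕ k) ∣ ≤ 1 → Walk (head f) f
steps⇒walk (a ∷ [])     steps last = end last
steps⇒walk (a ∷ b ∷ f) steps last = step (steps Fin.zero) (steps⇒walk (b ∷ f) (steps ∘ Fin.suc) last)

fromℕ-or-inject₁ : ∀ {k} (u : Fin (suc k)) → u ≡ fromℕ k ⊎ Σ (Fin k) (λ i → u ≡ inject₁ i)
fromℕ-or-inject₁ {zero}  Fin.zero    = inj₁ refl
fromℕ-or-inject₁ {suc k} Fin.zero    = inj₂ (Fin.zero , refl)
fromℕ-or-inject₁ {suc k} (Fin.suc u) with fromℕ-or-inject₁ u
... | inj₁ u≡k       = inj₁ (cong Fin.suc u≡k)
... | inj₂ (i , u≡i) = inj₂ (Fin.suc i , cong Fin.suc u≡i)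

toℕ-suc≡suc-inject₁ : ∀ {k} (i : Fin k) → toℕ (Fin.suc i) ≡ suc (toℕ (inject₁ i)) ℕ.% suc k
toℕ-suc≡suc-inject₁ {k} i = sym (trans (cong (λ n → suc n ℕ.% suc k) (Fin.toℕ-inject₁ i))
                                      (m<n⇒m%n≡m (s≤s (Fin.toℕ<n i))))

toℕ-zero≡suc-fromℕ : ∀ k → toℕ (Fin.zero {k}) ≡ suc (toℕ (fromℕ k)) ℕ.% suc k
toℕ-zero≡suc-fromℕ k = sym (trans (cong (λ n → suc n ℕ.% suc k) (Fin.toℕ-fromℕ k)) (n%n≡0 (suc k)))

successor-cases : ∀ {k} (u v : Fin (suc k)) → toℕ v ≡ suc (toℕ u) ℕ.% suc k →
                  Σ (Fin k) (λ i → u ≡ inject₁ i × v ≡ Fin.suc i) ⊎ (u ≡ fromℕ k × v ≡ Fin.zero)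
successor-cases {k} u v v≡u+1 with fromℕ-or-inject₁ u
... | inj₁ refl       = inj₂ (refl , Fin.toℕ-injective (trans v≡u+1 (sym (toℕ-zero≡suc-fromℕ k))))
... | inj₂ (i , refl) = inj₁ (i , refl , Fin.toℕ-injective (trans v≡u+1 (sym (toℕ-suc≡suc-inject₁ i))))

lipschitz⇔walk : ∀ k (f : Vec ℤ (suc k)) → IsLipschitz1 (cycle k) f ⇔ Walk 0ℤ f
lipschitz⇔walk k f@(x ∷ _) = mk⇔ to from
  where
  to : IsLipschitz1 (cycle k) f → Walk 0ℤ f
  to (x≡0 , lip) = subst (λ a → Walk a f) x≡0 (steps⇒walk f
    (λ i → lip (inject₁ i) (Fin.suc i) (inj₁ (toℕ-suc≡suc-inject₁ i)))
    (subst (_≤ 1) (trans (cong (λ y → ∣ lookup f (fromℕ k) - y ∣) x≡0) (∣i-0∣≡∣i∣ (lookup f (fromℕ k))))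
           (lip (fromℕ k) Fin.zero (inj₁ (toℕ-zero≡suc-fromℕ k)))))

  along : Walk 0ℤ f → ∀ u v → toℕ v ≡ suc (toℕ u) ℕ.% suc k → ∣ lookup f u - lookup f v ∣ ≤ 1
  along w u v v≡u+1 with successor-cases u v v≡u+1
  ... | inj₁ (i , refl , refl) = walk-steps w i
  ... | inj₂ (refl , refl)     =
    subst (_≤ 1) (sym (trans (cong (λ y → ∣ lookup f (fromℕ k) - y ∣) (walk-head w))
                             (∣i-0∣≡∣i∣ (lookup f (fromℕ k)))))
          (walk-last w)

  from : Walk 0ℤ f → IsLipschitz1 (cycle k) f
  from w = walk-head w , λ where
    u v (inj₁ v≡u+1) → along w u v v≡u+1
    u v (inj₂ u≡v+1) → subst (_≤ 1) (ℤ.∣i-j∣≡∣j-i∣ (lookup f v) (lookup f u)) (along w v u u≡v+1)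

walks-enumerate : ∀ k → Enumerates (cycle k) (walks k 0ℤ)
walks-enumerate k = walks-unique k 0ℤ , λ f → ⇔-sym (lipschitz⇔walk k f) ⇔-∘ ∈-walks⇔ k 0ℤ

enumerations-↭ : ∀ {G L L′} → Enumerates G L → Enumerates G L′ → L ↭ L′
enumerations-↭ (uL , L⇔) (uL′ , L′⇔) = unique-↭ uL uL′ (λ {f} → ⇔-sym (L′⇔ f) ⇔-∘ L⇔ f)

-- Parity sums of a trinomial row

interval : ℤ → ℕ → List ℤ
interval lo zero    = []
interval lo (suc c) = lo ∷ interval (ℤ.suc lo) c

∈-interval⁻ : ∀ {lo x} c → x ∈ interval lo c → lo ℤ.≤ x
∈-interval⁻ (suc c) (here refl)  = ℤ.≤-refl
∈-interval⁻ (suc c) (there x∈)   = ℤ.<⇒≤ (ℤ.suc[i]≤j⇒i<j (∈-interval⁻ c x∈))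

∈-interval⁺ : ∀ {lo x} c → lo ℤ.≤ x → x ℤ.< lo + + c → x ∈ interval lo c
∈-interval⁺ {lo} zero    lo≤x x<lo =
  ⊥-elim (ℤ.<-irrefl refl (ℤ.<-≤-trans (subst (_ ℤ.<_) (ℤ.+-identityʳ lo) x<lo) lo≤x))
∈-interval⁺ {lo} {x} (suc c) lo≤x x<hi with x ≟ lo
... | yes refl = here refl
... | no  x≢lo = there (∈-interval⁺ c (ℤ.i<j⇒suc[i]≤j (ℤ.≤∧≢⇒< lo≤x (x≢lo ∘ sym)))
                                      (subst (x ℤ.<_) (lo+[1+c]≡[1+lo]+c lo (+ c)) x<hi))
  where
  lo+[1+c]≡[1+lo]+c : ∀ lo c → lo + (1ℤ + c) ≡ (1ℤ + lo) + c
  lo+[1+c]≡[1+lo]+c = solve-∀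

interval-unique : ∀ lo c → Unique (interval lo c)
interval-unique lo zero    = []
interval-unique lo (suc c) =
  All.tabulate (λ x∈ lo≡x → ℤ.<-irrefl lo≡x (ℤ.suc[i]≤j⇒i<j (∈-interval⁻ c x∈)))
  ∷ interval-unique (ℤ.suc lo) c

sum-interval-telescope : ∀ (g : ℤ → ℕ) lo c →
  sum (map (g ∘ ℤ.suc) (interval lo c)) ℕ.+ g lo ≡ sum (map g (interval lo c)) ℕ.+ g (lo + + c)
sum-interval-telescope g lo zero    = cong g (sym (ℤ.+-identityʳ lo))
sum-interval-telescope g lo (suc c) = begin
  g (ℤ.suc lo) ℕ.+ S′ ℕ.+ g lo                 ≡⟨ cong (ℕ._+ g lo) (ℕ.+-comm (g (ℤ.suc lo)) S′) ⟩
  S′ ℕ.+ g (ℤ.suc lo) ℕ.+ g lo                 ≡⟨ cong (ℕ._+ g lo) (sum-interval-telescope g (ℤ.suc lo) c) ⟩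
  S ℕ.+ g (ℤ.suc lo + + c) ℕ.+ g lo            ≡⟨ xy∙z≈zx∙y S _ (g lo) ⟩
  g lo ℕ.+ S ℕ.+ g (ℤ.suc lo + + c)            ≡⟨ cong (λ x → g lo ℕ.+ S ℕ.+ g x) (shift lo (+ c)) ⟩
  g lo ℕ.+ S ℕ.+ g (lo + + suc c)              ∎
  where
  open ≡-Reasoning
  S  = sum (map g (interval (ℤ.suc lo) c))
  S′ = sum (map (g ∘ ℤ.suc) (interval (ℤ.suc lo) c))
  shift : ∀ lo c → (1ℤ + lo) + c ≡ lo + (1ℤ + c)
  shift = solve-∀

sum-interval-shift : ∀ (g : ℤ → ℕ) lo c → g lo ≡ 0 → g (lo + + c) ≡ 0 →
                     sum (map (g ∘ ℤ.suc) (interval lo c)) ≡ sum (map g (interval lo c))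
sum-interval-shift g lo c g[lo]≡0 g[hi]≡0 = begin
  S′          ≡⟨ ℕ.+-identityʳ S′ ⟨
  S′ ℕ.+ 0    ≡⟨ cong (S′ ℕ.+_) g[lo]≡0 ⟨
  S′ ℕ.+ g lo ≡⟨ sum-interval-telescope g lo c ⟩
  S ℕ.+ g (lo + + c) ≡⟨ cong (S ℕ.+_) g[hi]≡0 ⟩
  S ℕ.+ 0     ≡⟨ ℕ.+-identityʳ S ⟩
  S           ∎
  where
  open ≡-Reasoning
  S  = sum (map g (interval lo c))
  S′ = sum (map (g ∘ ℤ.suc) (interval lo c))

window : ℕ → List ℤ
window N = interval (- + N) (suc (N ℕ.+ N))

window-end : ∀ N → - + N + + suc (N ℕ.+ N) ≡ + suc N
window-end N = -n+[1+n+n]≡1+n (+ N)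
  where
  -n+[1+n+n]≡1+n : ∀ n → - n + (1ℤ + (n + n)) ≡ 1ℤ + n
  -n+[1+n+n]≡1+n = solve-∀

window-unique : ∀ N → Unique (window N)
window-unique N = interval-unique (- + N) (suc (N ℕ.+ N))

∈-window : ∀ N {x} → ∣ x ∣ ≤ N → x ∈ window N
∈-window N {x} ∣x∣≤N = ∈-interval⁺ (suc (N ℕ.+ N)) (lower x ∣x∣≤N)
  (subst (x ℤ.<_) (sym (window-end N)) (upper x ∣x∣≤N))
  where
  lower : ∀ x → ∣ x ∣ ≤ N → - + N ℤ.≤ x
  lower (+ _)      _     = ℤ.neg-≤-pos
  lower -[1+ _ ]   ∣x∣≤N = ℤ.neg-mono-≤ (ℤ.+≤+ ∣x∣≤N)
  upper : ∀ x → ∣ x ∣ ≤ N → x ℤ.< 1ℤ + + N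
  upper (+ _)      ∣x∣≤N = ℤ.+<+ (s≤s ∣x∣≤N)
  upper -[1+ _ ]   _     = ℤ.-<+

walk-values : ∀ {k a} {f : Vec ℤ (suc k)} → Walk a f → ∀ {x} → x ∈ toList f → ∣ x - a ∣ ≤ k
walk-values {a = a} (end _)    (here refl) = ∣i-i∣≤n a
walk-values {a = a} (step _ _) (here refl) = ∣i-i∣≤n a
walk-values {suc k} {a} (step {b = b} a~b w) {x} (there x∈) = begin
  ∣ x - a ∣                  ≡⟨ cong ∣_∣ (x-a≡[x-b]+[b-a] x a b) ⟩
  ∣ (x - b) + (b - a) ∣      ≤⟨ ℤ.∣i+j∣≤∣i∣+∣j∣ (x - b) (b - a) ⟩
  ∣ x - b ∣ ℕ.+ ∣ b - a ∣
    ≤⟨ ℕ.+-mono-≤ (walk-values w x∈) (subst (_≤ 1) (ℤ.∣i-j∣≡∣j-i∣ a b) a~b) ⟩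
  k ℕ.+ 1                    ≡⟨ ℕ.+-comm k 1 ⟩
  suc k                      ∎
  where
  open ℕ.≤-Reasoning
  x-a≡[x-b]+[b-a] : ∀ x a b → x - a ≡ (x - b) + (b - a)
  x-a≡[x-b]+[b-a] = solve-∀

-- Σ_{|v| ≤ N} T(n, 2v + s).  While n < N the edges of the window lie outside the support of row n,
-- which makes the sum 2-periodic in s.
paritySum : ℕ → ℕ → ℤ → ℕ
paritySum N n s = sum (map (λ v → trinomial n (v + v + s)) (window N))

module _ (N : ℕ) where

  paritySum-suc : ∀ n s → paritySum N (suc n) s ≡
                  paritySum N n (s - 1ℤ) ℕ.+ paritySum N n s ℕ.+ paritySum N n (s + 1ℤ)
  paritySum-suc n s = begin
    paritySum N (suc n) s
      ≡⟨ cong sum (List.map-cong recurrence (window N)) ⟩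
    sum (map (λ v → T₋ v ℕ.+ T₀ v ℕ.+ T₊ v) (window N))
      ≡⟨ sum-map-+ (λ v → T₋ v ℕ.+ T₀ v) T₊ (window N) ⟩
    sum (map (λ v → T₋ v ℕ.+ T₀ v) (window N)) ℕ.+ paritySum N n (s + 1ℤ)
      ≡⟨ cong (ℕ._+ paritySum N n (s + 1ℤ)) (sum-map-+ T₋ T₀ (window N)) ⟩
    paritySum N n (s - 1ℤ) ℕ.+ paritySum N n s ℕ.+ paritySum N n (s + 1ℤ)
      ∎
    where
    open ≡-Reasoning
    T₋ T₀ T₊ : ℤ → ℕ
    T₋ v = trinomial n (v + v + (s - 1ℤ))
    T₀ v = trinomial n (v + v + s)
    T₊ v = trinomial n (v + v + (s + 1ℤ))
    recurrence : ∀ v → trinomial (suc n) (v + v + s) ≡ T₋ v ℕ.+ T₀ v ℕ.+ T₊ v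
    recurrence v = cong₂ ℕ._+_ (cong₂ ℕ._+_ (cong (trinomial n) (ℤ.+-assoc (v + v) s (- 1ℤ))) refl)
                               (cong (trinomial n) (ℤ.+-assoc (v + v) s 1ℤ))

  paritySum-periodic : ∀ {n} → n < N → ∀ s → ∣ s ∣ ≤ 1 → paritySum N n (s + + 2) ≡ paritySum N n s
  paritySum-periodic {n} n<N s ∣s∣≤1 = begin
    paritySum N n (s + + 2)
      ≡⟨ cong sum (List.map-cong (λ v → cong (trinomial n) (shift v s)) (window N)) ⟩
    sum (map (g ∘ ℤ.suc) (window N))
      ≡⟨ sum-interval-shift g (- + N) (suc (N ℕ.+ N)) g[-N]≡0 g[1+N]≡0 ⟩
    paritySum N n s
      ∎
    where
    open ≡-Reasoning
    g : ℤ → ℕ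
    g v = trinomial n (v + v + s)
    shift : ∀ v s → v + v + (s + + 2) ≡ (1ℤ + v) + (1ℤ + v) + s
    shift = solve-∀
    g[-N]≡0 : g (- + N) ≡ 0
    g[-N]≡0 = trinomial-vanish-double n (- + N) s ∣s∣≤1 (subst (n <_) (sym (ℤ.∣-i∣≡∣i∣ (+ N))) n<N)
    g[1+N]≡0 : g (- + N + + suc (N ℕ.+ N)) ≡ 0
    g[1+N]≡0 = trans (cong g (window-end N))
                     (trinomial-vanish-double n (+ suc N) s ∣s∣≤1 (ℕ.m<n⇒m<1+n n<N))

  paritySum-zero-even : paritySum N 0 0ℤ ≡ 1
  paritySum-zero-even = sum-map-single _ (window-unique N) (∈-window N z≤n) vanish
    where
    vanish : ∀ v → v ≢ 0ℤ → trinomial 0 (v + v + 0ℤ) ≡ 0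
    vanish (+ zero)  v≢0 = ⊥-elim (v≢0 refl)
    vanish +[1+ _ ]  _   = refl
    vanish -[1+ _ ]  _   = refl

  paritySum-zero-odd : paritySum N 0 1ℤ ≡ 0
  paritySum-zero-odd = sum-map-zero _ (window N) (λ {v} _ → vanish v)
    where
    vanish : ∀ v → trinomial 0 (v + v + 1ℤ) ≡ 0
    vanish (+ zero)  = refl
    vanish +[1+ _ ]  = refl
    vanish -[1+ _ ]  = refl

  paritySum-sum-difference : ∀ n → n ≤ N →
    + paritySum N n 0ℤ + + paritySum N n 1ℤ ≡ (+ 3) ^ n ×
    + paritySum N n 0ℤ - + paritySum N n 1ℤ ≡ (- (+ 1)) ^ n
  paritySum-sum-difference zero _
    rewrite paritySum-zero-even | paritySum-zero-odd = refl , refl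
  paritySum-sum-difference (suc n) n<N =
    trans (cong₂ _+_ (cong +_ even) (cong +_ odd))
          (trans (sum-law (+ e) (+ o)) (cong (+ 3 ℤ.*_) e+o≡3ⁿ)) ,
    trans (cong₂ _-_ (cong +_ even) (cong +_ odd))
          (trans (difference-law (+ e) (+ o)) (cong (- (+ 1) ℤ.*_) e-o≡[-1]ⁿ))
    where
    e = paritySum N n 0ℤ
    o = paritySum N n 1ℤ
    e+o≡3ⁿ = proj₁ (paritySum-sum-difference n (ℕ.<⇒≤ n<N))
    e-o≡[-1]ⁿ = proj₂ (paritySum-sum-difference n (ℕ.<⇒≤ n<N))
    even : paritySum N (suc n) 0ℤ ≡ o ℕ.+ e ℕ.+ o
    even = trans (paritySum-suc n 0ℤ)
                 (cong (λ x → x ℕ.+ e ℕ.+ o) (sym (paritySum-periodic n<N (- 1ℤ) ℕ.≤-refl)))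
    odd : paritySum N (suc n) 1ℤ ≡ e ℕ.+ o ℕ.+ e
    odd = trans (paritySum-suc n 1ℤ) (cong (e ℕ.+ o ℕ.+_) (paritySum-periodic n<N 0ℤ z≤n))
    sum-law : ∀ e o → (o + e + o) + (e + o + e) ≡ + 3 ℤ.* (e + o)
    sum-law = solve-∀
    difference-law : ∀ e o → (o + e + o) - (e + o + e) ≡ - (+ 1) ℤ.* (e - o)
    difference-law = solve-∀

  twice-paritySum-even : ∀ n → n ≤ N → + (2 ℕ.* paritySum N n 0ℤ) ≡ (+ 3) ^ n + (- (+ 1)) ^ n
  twice-paritySum-even n n≤N = begin
    + (2 ℕ.* e)                   ≡⟨ twice (+ e) (+ o) ⟩
    (+ e + + o) + (+ e - + o)     ≡⟨ cong₂ _+_ e+o≡3ⁿ e-o≡[-1]ⁿ ⟩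
    (+ 3) ^ n + (- (+ 1)) ^ n     ∎
    where
    open ≡-Reasoning
    e = paritySum N n 0ℤ
    o = paritySum N n 1ℤ
    e+o≡3ⁿ = proj₁ (paritySum-sum-difference n n≤N)
    e-o≡[-1]ⁿ = proj₂ (paritySum-sum-difference n n≤N)
    twice : ∀ e o → e + (e + 0ℤ) ≡ (e + o) + (e - o)
    twice = solve-∀

-- Visits and the reflection principle

open import Data.List.Membership.DecPropositional _≟_ using (_∈?_)

visits : ℕ → ℤ → ℤ → ℕ
visits k a v = sum (map (λ f → indicator (v ∈? toList f)) (walks k a))

visits-self : ∀ k a → visits k a a ≡ trinomial (suc k) a
visits-self k a = begin
  visits k a a                     ≡⟨ length-filter≡sum-indicator visits-a? (walks k a) ⟨
  length (filter visits-a? (walks k a))  ≡⟨ cong length (List.filter-all visits-a? start∈) ⟩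
  length (walks k a)               ≡⟨ length-walks k a ⟩
  trinomial (suc k) a              ∎
  where
  open ≡-Reasoning
  visits-a? = λ (f : Vec ℤ (suc k)) → a ∈? toList f
  start∈ = All.tabulate λ f∈ → walk-start∈ (Equivalence.to (∈-walks⇔ k a) f∈)

indicator-∈-∷ : ∀ {v a} xs → v ≢ a → indicator (v ∈? a ∷ xs) ≡ indicator (v ∈? xs)
indicator-∈-∷ {v} {a} xs v≢a = indicator-⇔ (∈-∷⇔ v≢a) (v ∈? a ∷ xs) (v ∈? xs)

visits-zero : ∀ {a v} → v ≢ a → visits 0 a v ≡ 0
visits-zero {a} {v} v≢a = sum-map-zero _ (walks 0 a) (not-visited ∘ Equivalence.to (∈-walks⇔ 0 a))
  where
  not-visited : ∀ {f} → Walk a f → indicator (v ∈? toList f) ≡ 0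
  not-visited (end _) = indicator-∈-∷ [] v≢a

visits-step : ∀ k {a v} → v ≢ a →
              visits (suc k) a v ≡ visits k (a - 1ℤ) v ℕ.+ visits k a v ℕ.+ visits k (a + 1ℤ) v
visits-step k {a} {v} v≢a = begin
  sum (map χ (map (a ∷_) (W₋ ++ W₀ ++ W₊)))       ≡⟨ cong sum (List.map-∘ (W₋ ++ W₀ ++ W₊)) ⟨
  sum (map (χ ∘ (a ∷_)) (W₋ ++ W₀ ++ W₊))
    ≡⟨ cong sum (List.map-cong (λ g → indicator-∈-∷ (toList g) v≢a) (W₋ ++ W₀ ++ W₊)) ⟩
  sum (map χ (W₋ ++ W₀ ++ W₊))                    ≡⟨ sum-map-++ χ W₋ (W₀ ++ W₊) ⟩
  sum (map χ W₋) ℕ.+ sum (map χ (W₀ ++ W₊))       ≡⟨ cong (sum (map χ W₋) ℕ.+_) (sum-map-++ χ W₀ W₊) ⟩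
  sum (map χ W₋) ℕ.+ (sum (map χ W₀) ℕ.+ sum (map χ W₊)) ≡⟨ ℕ.+-assoc (sum (map χ W₋)) _ _ ⟨
  visits k (a - 1ℤ) v ℕ.+ visits k a v ℕ.+ visits k (a + 1ℤ) v ∎
  where
  open ≡-Reasoning
  χ : ∀ {m} → Vec ℤ m → ℕ
  χ f = indicator (v ∈? toList f)
  W₋ = walks k (a - 1ℤ)
  W₀ = walks k a
  W₊ = walks k (a + 1ℤ)

i≢i-[1+n] : ∀ i n → i ≢ i - + suc n
i≢i-[1+n] i n i≡i-[1+n] = +-cancelˡ-≢ i {0ℤ} { -[1+ n ]} (λ ()) (trans (ℤ.+-identityʳ i) i≡i-[1+n])

-- Reflection principle: for a ≤ v both sides obey the trinomial recurrence in a (visits-step),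
-- and they agree at a = v and for walks of length 0.
visits-reflect : ∀ p k d → visits k (+[1+ p ] - + d) +[1+ p ] ≡ trinomial (suc k) (+[1+ p ] + + d)
visits-reflect p k zero = begin
  visits k (v - + 0) v         ≡⟨ cong (λ a → visits k a v) (ℤ.+-identityʳ v) ⟩
  visits k v v                 ≡⟨ visits-self k v ⟩
  trinomial (suc k) v          ≡⟨ cong (trinomial (suc k)) (ℤ.+-identityʳ v) ⟨
  trinomial (suc k) (v + + 0)  ∎
  where
  open ≡-Reasoning
  v = +[1+ p ]
visits-reflect p zero (suc d) =
  trans (visits-zero (i≢i-[1+n] +[1+ p ] d))
        (sym (trinomial-vanish 1 (+[1+ p ] + + suc d) (s≤s (ℕ.≤-trans (s≤s z≤n) (ℕ.m≤n+m (suc d) p)))))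
visits-reflect p (suc k) (suc d) = begin
  visits (suc k) a v
    ≡⟨ visits-step k (i≢i-[1+n] v d) ⟩
  visits k (a - 1ℤ) v ℕ.+ visits k a v ℕ.+ visits k (a + 1ℤ) v
    ≡⟨ cong₂ ℕ._+_
         (cong₂ ℕ._+_ (trans (cong (λ b → visits k b v) (left v (+ d))) (visits-reflect p k (2 ℕ.+ d)))
                      (visits-reflect p k (suc d)))
         (trans (cong (λ b → visits k b v) (right v (+ d))) (visits-reflect p k d)) ⟩
  T (v + + (2 ℕ.+ d)) ℕ.+ T (v + + suc d) ℕ.+ T (v + + d)
    ≡⟨ xy∙z≈zy∙x (T (v + + (2 ℕ.+ d))) (T (v + + suc d)) (T (v + + d)) ⟩
  T (v + + d) ℕ.+ T (v + + suc d) ℕ.+ T (v + + (2 ℕ.+ d))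
    ≡⟨ cong₂ ℕ._+_ (cong₂ ℕ._+_ (cong T (below v (+ d))) refl) (cong T (above v (+ d))) ⟩
  trinomial (suc (suc k)) (v + + suc d)
    ∎
  where
  open ≡-Reasoning
  v = +[1+ p ]
  a = v - + suc d
  T = trinomial (suc k)
  left : ∀ v x → v - (1ℤ + x) - 1ℤ ≡ v - (1ℤ + (1ℤ + x))
  left = solve-∀
  right : ∀ v x → v - (1ℤ + x) + 1ℤ ≡ v - x
  right = solve-∀
  below : ∀ v x → v + x ≡ v + (1ℤ + x) - 1ℤ
  below = solve-∀
  above : ∀ v x → v + (1ℤ + (1ℤ + x)) ≡ v + (1ℤ + x) + 1ℤ
  above = solve-∀

visits-neg : ∀ k a v → visits k (- a) (- v) ≡ visits k a v
visits-neg k a v with v ≟ a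
... | yes refl = trans (visits-self k (- a)) (trans (trinomial-neg (suc k) a) (sym (visits-self k a)))
visits-neg zero    a v | no v≢a = trans (visits-zero (v≢a ∘ ℤ.neg-injective)) (sym (visits-zero v≢a))
visits-neg (suc k) a v | no v≢a = begin
  visits (suc k) (- a) (- v)
    ≡⟨ visits-step k (v≢a ∘ ℤ.neg-injective) ⟩
  V (- a - 1ℤ) (- v) ℕ.+ V (- a) (- v) ℕ.+ V (- a + 1ℤ) (- v)
    ≡⟨ cong₂ ℕ._+_ (cong₂ ℕ._+_ (trans (cong (λ b → V b (- v)) (-i-1≡-[i+1] a)) (visits-neg k (a + 1ℤ) v))
                                (visits-neg k a v))
                   (trans (cong (λ b → V b (- v)) (-i+1≡-[i-1] a)) (visits-neg k (a - 1ℤ) v)) ⟩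
  V (a + 1ℤ) v ℕ.+ V a v ℕ.+ V (a - 1ℤ) v
    ≡⟨ xy∙z≈zy∙x (V (a + 1ℤ) v) (V a v) (V (a - 1ℤ) v) ⟩
  V (a - 1ℤ) v ℕ.+ V a v ℕ.+ V (a + 1ℤ) v
    ≡⟨ visits-step k v≢a ⟨
  visits (suc k) a v
    ∎
  where
  open ≡-Reasoning
  V = visits k

visits-origin : ∀ k v → visits k 0ℤ v ≡ trinomial (suc k) (v + v)
visits-origin k (+ zero)  = visits-self k 0ℤ
visits-origin k +[1+ p ]  =
  trans (cong (λ a → visits k a +[1+ p ]) (sym (ℤ.+-inverseʳ +[1+ p ]))) (visits-reflect p k (suc p))
visits-origin k -[1+ p ]  = begin
  visits k 0ℤ -[1+ p ]                    ≡⟨ visits-neg k 0ℤ +[1+ p ] ⟩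
  visits k 0ℤ +[1+ p ]                    ≡⟨ visits-origin k +[1+ p ] ⟩
  trinomial (suc k) (+[1+ p ] + +[1+ p ]) ≡⟨ trinomial-neg (suc k) _ ⟨
  trinomial (suc k) (- (+[1+ p ] + +[1+ p ])) ≡⟨ cong (trinomial (suc k)) (ℤ.neg-distrib-+ +[1+ p ] +[1+ p ]) ⟩
  trinomial (suc k) (-[1+ p ] + -[1+ p ]) ∎
  where open ≡-Reasoning

sum-rng-walks : ∀ k → sum (map rng (walks k 0ℤ)) ≡ paritySum (suc k) (suc k) 0ℤ
sum-rng-walks k = begin
  sum (map rng W)
    ≡⟨ cong sum (List.map-cong-local (All.tabulate λ {f} f∈W →
         length-deduplicate _≟_ (toList f) R (window-unique (suc k)) (values f∈W))) ⟩
  sum (map (λ f → sum (map (λ v → indicator (v ∈? toList f)) R)) W)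
    ≡⟨ sum-map-comm (λ f v → indicator (v ∈? toList f)) W R ⟩
  sum (map (visits k 0ℤ) R)
    ≡⟨ cong sum (List.map-cong (λ v → trans (visits-origin k v)
                                             (cong (trinomial (suc k)) (sym (ℤ.+-identityʳ (v + v))))) R) ⟩
  paritySum (suc k) (suc k) 0ℤ
    ∎
  where
  open ≡-Reasoning
  W = walks k 0ℤ
  R = window (suc k)
  values : ∀ {f} → f ∈ W → ∀ {x} → x ∈ toList f → x ∈ R
  values f∈W {x} x∈f = ∈-window (suc k) (ℕ.m≤n⇒m≤1+n
    (subst (_≤ k) (∣i-0∣≡∣i∣ x) (walk-values (Equivalence.to (∈-walks⇔ k 0ℤ) f∈W) x∈f)))

frac-cancel : ∀ m a b → frac (+ (suc m ℕ.* a)) (suc m ℕ.* b) ≡ frac (+ a) b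
frac-cancel m a zero    rewrite ℕ.*-zeroʳ m = refl
frac-cancel m a (suc d) =
  ℚ.fromℚᵘ-cong {ℚᵘ.mkℚᵘ (+ (suc m ℕ.* a)) (d ℕ.+ m ℕ.* suc d)} {ℚᵘ.mkℚᵘ (+ a) d} (ℚᵘ.*≡* (begin
    + (suc m ℕ.* a) ℤ.* + suc d     ≡⟨ ℤ.pos-* (suc m ℕ.* a) (suc d) ⟨
    + (suc m ℕ.* a ℕ.* suc d)       ≡⟨ cong +_ (trans (cong (ℕ._* suc d) (ℕ.*-comm (suc m) a))
                                                      (ℕ.*-assoc a (suc m) (suc d))) ⟩
    + (a ℕ.* (suc m ℕ.* suc d))     ≡⟨ ℤ.pos-* a (suc m ℕ.* suc d) ⟩
    + a ℤ.* + (suc m ℕ.* suc d)     ∎))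
  where open ≡-Reasoning

avgOf-cycle : ∀ k L → Enumerates (cycle k) L →
              avgOf L ≡ frac ((+ 3) ^ suc k + (- (+ 1)) ^ suc k) (2 ℕ.* centralTrinomial (suc k))
avgOf-cycle k L L-enum = begin
  frac (+ sum (map rng L)) (length L)
    ≡⟨ cong₂ (λ s c → frac (+ s) c) (sum-↭ (↭.map⁺ rng L↭W)) (↭-length L↭W) ⟩
  frac (+ sum (map rng W)) (length W)
    ≡⟨ cong₂ (λ s c → frac (+ s) c) (sum-rng-walks k) (length-walks k 0ℤ) ⟩
  frac (+ e) (centralTrinomial (suc k))
    ≡⟨ frac-cancel 1 e (centralTrinomial (suc k)) ⟨
  frac (+ (2 ℕ.* e)) (2 ℕ.* centralTrinomial (suc k))
    ≡⟨ cong (λ x → frac x (2 ℕ.* centralTrinomial (suc k))) (twice-paritySum-even (suc k) (suc k) ℕ.≤-refl) ⟩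
  frac ((+ 3) ^ suc k + (- (+ 1)) ^ suc k) (2 ℕ.* centralTrinomial (suc k))
    ∎
  where
  open ≡-Reasoning
  W = walks k 0ℤ
  L↭W = enumerations-↭ L-enum (walks-enumerate k)
  e = paritySum (suc k) (suc k) 0ℤ

theorem6 : (m : ℕ) → let n = 3 Data.Nat.+ m in
    Σ (List (Vec ℤ n)) (λ L → Enumerates (cycle (2 Data.Nat.+ m)) L) ×
    ((L : List (Vec ℤ n)) → Enumerates (cycle (2 Data.Nat.+ m)) L →
      avgOf L ≡ frac ((+ 3) ^ n + (- (+ 1)) ^ n) (2 Data.Nat.* centralTrinomial n))
theorem6 m = (walks (2 ℕ.+ m) 0ℤ , walks-enumerate (2 ℕ.+ m)) , avgOf-cycle (2 ℕ.+ m)
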